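{- Let $X$, $Y$ be finite nonempty sets, $F: X\to 2^Y$ a set-valued mapping, $W\subset X$ a critical set of $F$, $(W_1,\ldots,W_m)$ a Hall partition of $F$, and $1\le i\le m$ such that $W\subset X\setminus(W_1\cup\cdots\cup W_{i-1})$. Then $W$ is a critical set of $F_{W_1\cup\cdots\cup W_{i-1}}$.
   Context: A set-valued mapping $F: X \to 2^Y$ assigns to each $x$ a (possibly empty) subset $F(x) \subset Y$; $F(W) = \bigcup_{x\in W}F(x)$; $\sharp$ is cardinality. For $W \subset X$, $F_W: X\setminus W \to 2^Y$ is $F_W(x) = F(x) \setminus F(W)$ ($F_\emptyset=F$). For set-valued $G$ on a finite set, a subset $W$ of its domain is critical for $G$ if $W\ne\emptyset$ and $\sharp G(W)=\sharp W$; non-reducible for $G$ if $W\ne\emptyset$ and no proper subset of $W$ is critical for $G$. A tuple $(W_1,\ldots,W_m)$, $m\ge1$, is a Hall partition of $F$ if the $W_i$ are nonempty, pairwise disjoint with union $X$, and with $G_i = F_{W_1\cup\cdots\cup W_{i-1}}$ ($G_1=F$): (i) $G_i(x)\neq\emptyset$ for $x \in W_i$; (ii) $W_i$ is non-reducible for $G_i$; (iii) $W_i$ is critical for $G_i$ for $i \le m-1$. -}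

module Defs where

open import Data.Nat using (ℕ; zero; suc; _<_; _≤_)
open import Data.Nat.Properties using (_<?_)
open import Data.Bool using (if_then_else_)
open import Data.Fin using (Fin; toℕ)
import Data.Fin as Fin
open import Data.Fin.Subset
open import Data.Vec using (_∷_; []; tabulate)
open import Data.Product using (_×_)
open import Relation.Nullary using (¬_)
open import Relation.Nullary.Decidable using (⌊_⌋)
open import Relation.Binary.PropositionalEquality using (_≡_; _≢_)

-- X = Fin n, Y = Fin k; a set-valued mapping X → 2^Y is  Fin n → Subset k.

image : ∀ {n k} → (Fin n → Subset k) → Subset n → Subset k
image {zero}  F []      = ⊥
image {suc n} F (b ∷ W) =
  (if b then F Fin.zero else ⊥) ∪ image (λ x → F (Fin.suc x)) W

-- F_U(x) = F(x) \ F(U); its domain is X \ U (= ∁ U).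
restrict : ∀ {n k} → (Fin n → Subset k) → Subset n → (Fin n → Subset k)
restrict F U x = F x ─ image F U

-- A set-valued map G with domain D ⊆ X is given by (D , G) with G total
-- (values outside D are irrelevant).
-- W is critical for G: W ⊆ dom, W ≠ ∅, ♯G(W) = ♯W.
Critical : ∀ {n k} → Subset n → (Fin n → Subset k) → Subset n → Set
Critical D G W = W ⊆ D × Nonempty W × ∣ image G W ∣ ≡ ∣ W ∣

NonReducible : ∀ {n k} → Subset n → (Fin n → Subset k) → Subset n → Set
NonReducible D G W =
  W ⊆ D × Nonempty W × (∀ V → V ⊂ W → ¬ Critical D G V)

below : ∀ {m} → Fin m → Subset m
below i = tabulate (λ j → ⌊ toℕ j <? toℕ i ⌋)

-- W_1 ∪ ... ∪ W_{i-1}  (0-indexed: union of Ws j for j < i)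
prefix : ∀ {m n} → (Fin m → Subset n) → Fin m → Subset n
prefix Ws i = image Ws (below i)

record HallPartition {n k} (F : Fin n → Subset k) (m : ℕ)
                     (Ws : Fin m → Subset n) : Set where
  field
    m≥1       : 1 ≤ m
    nonempty  : ∀ i → Nonempty (Ws i)
    disjoint  : ∀ i j → i ≢ j → Empty (Ws i ∩ Ws j)
    covers    : image Ws ⊤ ≡ ⊤
    nonemptyValues : ∀ i x → x ∈ Ws i →
      Nonempty (restrict F (prefix Ws i) x)
    nonReducible : ∀ i →
      NonReducible (∁ (prefix Ws i)) (restrict F (prefix Ws i)) (Ws i)
    critical : ∀ i → suc (toℕ i) < m →
      Critical (∁ (prefix Ws i)) (restrict F (prefix Ws i)) (Ws i)

{-# OPTIONS --safe #-}
module Submission where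

-- Every G_j = F_{W_1 ∪ ⋯ ∪ W_{j-1}} satisfies Hall's condition ♯V ≤ ♯G_j(V) on its
-- domain X ∖ (W_1 ∪ ⋯ ∪ W_{j-1}), by downward induction on j: on W_j this is
-- non-reducibility, and a general V splits as V ∩ W_j and V ∖ W_j, whose images under
-- G_j and G_{j+1} are disjoint subsets of G_j(V). For W critical for F this gives
-- ♯W ≤ ♯G_i(W) ≤ ♯F(W) = ♯W.

open import Defs
open import Data.Nat using (ℕ; zero; suc; _+_; _∸_; _≤_; _<_; z≤n; s≤s)
open import Data.Nat.Properties
  using (_<?_; ≤-refl; ≤-antisym; ≤∧≢⇒<; <-≤-trans; <⇒≤; +-mono-≤; +-monoˡ-≤; +-suc;
         m≤n+m; m<1+n⇒m<n∨m≡n; m<n⇒m<1+n; m∸n+n≡m; module ≤-Reasoning)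
open import Data.Bool using (Bool; T; true; false; if_then_else_)
open import Data.Bool.Properties using (T-≡)
open import Data.Fin using (Fin; toℕ; fromℕ<)
import Data.Fin as Fin
open import Data.Fin.Properties using (toℕ<n; toℕ-fromℕ<; toℕ-injective)
open import Data.Fin.Subset
  using (Subset; _⊆_; ∁; ⊤; ⊥; _∈_; _∉_; _∪_; _∩_; _─_; _-_; ⁅_⁆; ∣_∣; Nonempty; Empty; _⊂_; inside; outside)
open import Data.Fin.Subset.Properties
open import Data.Fin.Subset.Induction using (⊂-wellFounded)
open import Data.Vec using (_∷_; []; tabulate; here; there)
open import Data.Vec.Properties using (lookup∘tabulate; []=⇒lookup; lookup⇒[]=)
open import Data.Product using (∃; _×_; _,_)
open import Data.Sum using (inj₁; inj₂; [_,_])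
open import Data.Empty using (⊥-elim)
open import Function using (id; _∘_)
open import Function.Bundles using (Equivalence)
open import Induction.WellFounded using (Acc; acc)
open import Relation.Nullary using (Dec; yes; no; contradiction)
open import Relation.Nullary.Decidable using (⌊_⌋; toWitness; fromWitness)
open import Relation.Binary.PropositionalEquality using (_≡_; refl; sym; trans; cong; subst)

x∈p─q⇒x∉q : ∀ {n} {p q : Subset n} {x} → x ∈ p ─ q → x ∉ q
x∈p─q⇒x∉q {p = _ ∷ _} {_ ∷ _} (there x∈p─q) (there x∈q) = x∈p─q⇒x∉q x∈p─q x∈q

∣p∣≡∣p∩q∣+∣p─q∣ : ∀ {n} (p q : Subset n) → ∣ p ∣ ≡ ∣ p ∩ q ∣ + ∣ p ─ q ∣
∣p∣≡∣p∩q∣+∣p─q∣ []           []           = refl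
∣p∣≡∣p∩q∣+∣p─q∣ (inside ∷ p)  (inside ∷ q)  = cong suc (∣p∣≡∣p∩q∣+∣p─q∣ p q)
∣p∣≡∣p∩q∣+∣p─q∣ (inside ∷ p)  (outside ∷ q) =
  trans (cong suc (∣p∣≡∣p∩q∣+∣p─q∣ p q)) (sym (+-suc ∣ p ∩ q ∣ ∣ p ─ q ∣))
∣p∣≡∣p∩q∣+∣p─q∣ (outside ∷ p) (inside ∷ q)  = ∣p∣≡∣p∩q∣+∣p─q∣ p q
∣p∣≡∣p∩q∣+∣p─q∣ (outside ∷ p) (outside ∷ q) = ∣p∣≡∣p∩q∣+∣p─q∣ p q

∣p∣+∣q∣≤∣p∪q∣ : ∀ {n} (p q : Subset n) → Empty (p ∩ q) → ∣ p ∣ + ∣ q ∣ ≤ ∣ p ∪ q ∣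
∣p∣+∣q∣≤∣p∪q∣ []            []            _     = z≤n
∣p∣+∣q∣≤∣p∪q∣ (inside ∷ p)  (inside ∷ q)  p∩q=∅ = contradiction (Fin.zero , here) p∩q=∅
∣p∣+∣q∣≤∣p∪q∣ (inside ∷ p)  (outside ∷ q) p∩q=∅ = s≤s (∣p∣+∣q∣≤∣p∪q∣ p q (drop-∷-Empty p∩q=∅))
∣p∣+∣q∣≤∣p∪q∣ (outside ∷ p) (inside ∷ q)  p∩q=∅
  rewrite +-suc ∣ p ∣ ∣ q ∣ = s≤s (∣p∣+∣q∣≤∣p∪q∣ p q (drop-∷-Empty p∩q=∅))
∣p∣+∣q∣≤∣p∪q∣ (outside ∷ p) (outside ∷ q) p∩q=∅ = ∣p∣+∣q∣≤∣p∪q∣ p q (drop-∷-Empty p∩q=∅)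

Empty⇒∣p∣≡0 : ∀ {n} {p : Subset n} → Empty p → ∣ p ∣ ≡ 0
Empty⇒∣p∣≡0 {n} p=∅ = trans (cong ∣_∣ (Empty-unique p=∅)) (∣⊥∣≡0 n)

Nonempty⇒∣p∣>0 : ∀ {n} {p : Subset n} → Nonempty p → 0 < ∣ p ∣
Nonempty⇒∣p∣>0 {p = p} (y , y∈p) =
  subst (_≤ ∣ p ∣) (∣⁅x⁆∣≡1 y)
    (p⊆q⇒∣p∣≤∣q∣ (λ x∈⁅y⁆ → subst (_∈ p) (sym (x∈⁅y⁆⇒x≡y y x∈⁅y⁆)) y∈p))

∣p∣≤1+∣p-x∣ : ∀ {n} (p : Subset n) x → ∣ p ∣ ≤ suc ∣ p - x ∣
∣p∣≤1+∣p-x∣ p x = subst (_≤ suc ∣ p - x ∣) (sym (∣p∣≡∣p∩q∣+∣p─q∣ p ⁅ x ⁆))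
  (+-monoˡ-≤ ∣ p - x ∣ (subst (∣ p ∩ ⁅ x ⁆ ∣ ≤_) (∣⁅x⁆∣≡1 x) (∣p∩q∣≤∣q∣ p ⁅ x ⁆)))

x∈tabulate⇒T : ∀ {n} {f : Fin n → Bool} {x} → x ∈ tabulate f → T (f x)
x∈tabulate⇒T {f = f} {x} x∈ =
  Equivalence.from T-≡ (trans (sym (lookup∘tabulate f x)) ([]=⇒lookup x∈))

T⇒x∈tabulate : ∀ {n} {f : Fin n → Bool} {x} → T (f x) → x ∈ tabulate f
T⇒x∈tabulate {f = f} {x} t = lookup⇒[]= x _ (trans (lookup∘tabulate f x) (Equivalence.to T-≡ t))

y∈image⁺ : ∀ {n k} (G : Fin n → Subset k) {W x y} → x ∈ W → y ∈ G x → y ∈ image G W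
y∈image⁺ G {true ∷ W} here y∈Gx = x∈p∪q⁺ (inj₁ y∈Gx)
y∈image⁺ G {b ∷ W} (there x∈W) y∈Gx =
  x∈p∪q⁺ {p = if b then G Fin.zero else ⊥} (inj₂ (y∈image⁺ (G ∘ Fin.suc) x∈W y∈Gx))

y∈image⁻ : ∀ {n k} (G : Fin n → Subset k) {W y} → y ∈ image G W → ∃ λ x → x ∈ W × y ∈ G x
y∈image⁻ G {[]} y∈ = ⊥-elim (∉⊥ y∈)
y∈image⁻ G {b ∷ W} y∈ with x∈p∪q⁻ (if b then G Fin.zero else ⊥) _ y∈
y∈image⁻ G {true ∷ W}  y∈ | inj₁ y∈G0 = Fin.zero , here , y∈G0
y∈image⁻ G {false ∷ W} y∈ | inj₁ y∈⊥  = ⊥-elim (∉⊥ y∈⊥)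
... | inj₂ y∈rest with y∈image⁻ (G ∘ Fin.suc) y∈rest
...   | x , x∈W , y∈Gx = Fin.suc x , there x∈W , y∈Gx

image-mono : ∀ {n k} {G H : Fin n → Subset k} {W V : Subset n} →
  (∀ {x} → G x ⊆ H x) → W ⊆ V → image G W ⊆ image H V
image-mono {G = G} {H} G⊆H W⊆V y∈ with y∈image⁻ G y∈
... | x , x∈W , y∈Gx = y∈image⁺ H (W⊆V x∈W) (G⊆H y∈Gx)

y∈image-restrict⇒y∉image : ∀ {n k} {F : Fin n → Subset k} {U W : Subset n} {y} →
  y ∈ image (restrict F U) W → y ∉ image F U
y∈image-restrict⇒y∉image {F = F} {U} y∈ with y∈image⁻ (restrict F U) y∈
... | _ , _ , y∈F─FU = x∈p─q⇒x∉q y∈F─FU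

restrict-antitone : ∀ {n k} {F : Fin n → Subset k} {U U′ : Subset n} {x} →
  U ⊆ U′ → restrict F U′ x ⊆ restrict F U x
restrict-antitone {F = F} {x = x} U⊆U′ y∈ =
  x∈p∧x∉q⇒x∈p─q (p─q⊆p (F x) _ y∈) (x∈p─q⇒x∉q y∈ ∘ image-mono id U⊆U′)

Hall : ∀ {n k} → (Fin n → Subset k) → Subset n → Set
Hall G D = ∀ V → V ⊆ D → ∣ V ∣ ≤ ∣ image G V ∣

-- Remove a point x from U: either U - x is empty and G x ≠ ∅ pays for x, or U - x
-- is a proper nonempty subset of W, hence not critical, and its strict inequality does.
NonReducible⇒Hall : ∀ {n k} {D W : Subset n} {G : Fin n → Subset k} →
  NonReducible D G W → (∀ {x} → x ∈ W → Nonempty (G x)) → Hall G W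
NonReducible⇒Hall {D = D} {W} {G} (W⊆D , _ , noCriticalBelow) G≠∅ U U⊆W =
  go U U⊆W (⊂-wellFounded U)
  where
  open ≤-Reasoning
  go : ∀ U → U ⊆ W → Acc _⊂_ U → ∣ U ∣ ≤ ∣ image G U ∣
  go U U⊆W (acc below) with nonempty? U
  ... | no  U=∅ = subst (_≤ ∣ image G U ∣) (sym (Empty⇒∣p∣≡0 U=∅)) z≤n
  ... | yes (x , x∈U) = begin
    ∣ U ∣             ≤⟨ ∣p∣≤1+∣p-x∣ U x ⟩
    suc ∣ U - x ∣     ≤⟨ remaining (nonempty? (U - x)) ⟩
    ∣ image G U ∣     ∎
    where
    U-x⊂U : U - x ⊂ U
    U-x⊂U = x∈p⇒p-x⊂p x∈U
    remaining : Dec (Nonempty (U - x)) → suc ∣ U - x ∣ ≤ ∣ image G U ∣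
    remaining (no U-x=∅) with G≠∅ (U⊆W x∈U)
    ... | y , y∈Gx = subst (λ s → suc s ≤ ∣ image G U ∣) (sym (Empty⇒∣p∣≡0 U-x=∅))
                       (Nonempty⇒∣p∣>0 (y , y∈image⁺ G x∈U y∈Gx))
    remaining (yes U-x≠∅) = <-≤-trans
      (≤∧≢⇒< (go (U - x) (U⊆W ∘ p⊂q⇒p⊆q U-x⊂U) (below U-x⊂U))
        λ ∣U-x∣≡∣G[U-x]∣ → noCriticalBelow (U - x) (⊂-⊆-trans U-x⊂U U⊆W)
          (W⊆D ∘ U⊆W ∘ p⊂q⇒p⊆q U-x⊂U , U-x≠∅ , sym ∣U-x∣≡∣G[U-x]∣))
      (p⊆q⇒∣p∣≤∣q∣ (image-mono id (p⊂q⇒p⊆q U-x⊂U)))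

-- The images of V ∩ Z under F_U and of V ─ Z under F_{U ∪ Z} are disjoint parts of F_U(V).
Hall-∪ : ∀ {n k} {F : Fin n → Subset k} {U Z : Subset n} →
  Hall (restrict F U) Z → Hall (restrict F (U ∪ Z)) (∁ (U ∪ Z)) →
  Hall (restrict F U) (∁ U)
Hall-∪ {k = k} {F} {U} {Z} hallZ hallRest V V⊆∁U = begin
  ∣ V ∣                       ≡⟨ ∣p∣≡∣p∩q∣+∣p─q∣ V Z ⟩
  ∣ V ∩ Z ∣ + ∣ V ─ Z ∣        ≤⟨ +-mono-≤ (hallZ (V ∩ Z) (p∩q⊆q V Z)) (hallRest (V ─ Z) V─Z⊆∁U∪Z) ⟩
  ∣ A ∣ + ∣ B ∣               ≤⟨ ∣p∣+∣q∣≤∣p∪q∣ A B A∩B=∅ ⟩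
  ∣ A ∪ B ∣                   ≤⟨ p⊆q⇒∣p∣≤∣q∣ A∪B⊆ ⟩
  ∣ image (restrict F U) V ∣  ∎
  where
  open ≤-Reasoning
  A B : Subset k
  A = image (restrict F U) (V ∩ Z)
  B = image (restrict F (U ∪ Z)) (V ─ Z)
  V─Z⊆∁U∪Z : V ─ Z ⊆ ∁ (U ∪ Z)
  V─Z⊆∁U∪Z x∈V─Z = x∉p⇒x∈∁p λ x∈U∪Z →
    [ x∈∁p⇒x∉p (V⊆∁U (p─q⊆p V Z x∈V─Z)) , x∈p─q⇒x∉q x∈V─Z ] (x∈p∪q⁻ U Z x∈U∪Z)
  A∩B=∅ : Empty (A ∩ B)
  A∩B=∅ (y , y∈A∩B) with x∈p∩q⁻ A B y∈A∩B
  ... | y∈A , y∈B = y∈image-restrict⇒y∉image {F = F} {U ∪ Z} y∈B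
    (image-mono (λ {x} → p─q⊆p (F x) _) (q⊆p∪q U Z ∘ p∩q⊆q V Z) y∈A)
  A∪B⊆ : A ∪ B ⊆ image (restrict F U) V
  A∪B⊆ y∈A∪B =
    [ image-mono id (p∩q⊆p V Z) , image-mono (restrict-antitone (p⊆p∪q Z)) (p─q⊆p V Z) ]
      (x∈p∪q⁻ A B y∈A∪B)

-- prefix Ws i is definitionally unionBelow Ws (toℕ i).
unionBelow : ∀ {m n} → (Fin m → Subset n) → ℕ → Subset n
unionBelow Ws j = image Ws (tabulate λ i → ⌊ toℕ i <? j ⌋)

x∈unionBelow⁺ : ∀ {m n} (Ws : Fin m → Subset n) {j i x} →
  toℕ i < j → x ∈ Ws i → x ∈ unionBelow Ws j
x∈unionBelow⁺ Ws i<j = y∈image⁺ Ws (T⇒x∈tabulate (fromWitness i<j))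

x∈unionBelow⁻ : ∀ {m n} {Ws : Fin m → Subset n} {j x} →
  x ∈ unionBelow Ws j → ∃ λ i → toℕ i < j × x ∈ Ws i
x∈unionBelow⁻ {Ws = Ws} x∈ with y∈image⁻ Ws x∈
... | i , i∈ , x∈Wsi = i , toWitness (x∈tabulate⇒T i∈) , x∈Wsi

unionBelow-suc : ∀ {m n} (Ws : Fin m → Subset n) i →
  unionBelow Ws (suc (toℕ i)) ≡ prefix Ws i ∪ Ws i
unionBelow-suc Ws i = ⊆-antisym ⊆∪ ∪⊆
  where
  ⊆∪ : unionBelow Ws (suc (toℕ i)) ⊆ prefix Ws i ∪ Ws i
  ⊆∪ x∈ with x∈unionBelow⁻ x∈
  ... | i′ , i′<1+i , x∈Wsi′ with m<1+n⇒m<n∨m≡n i′<1+i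
  ...   | inj₁ i′<i = x∈p∪q⁺ (inj₁ (x∈unionBelow⁺ Ws i′<i x∈Wsi′))
  ...   | inj₂ i′≡i = x∈p∪q⁺ (inj₂ (subst (λ i → _ ∈ Ws i) (toℕ-injective i′≡i) x∈Wsi′))
  ∪⊆ : prefix Ws i ∪ Ws i ⊆ unionBelow Ws (suc (toℕ i))
  ∪⊆ x∈ with x∈p∪q⁻ (prefix Ws i) (Ws i) x∈
  ... | inj₁ x∈prefix with x∈unionBelow⁻ x∈prefix
  ...   | i′ , i′<i , x∈Wsi′ = x∈unionBelow⁺ Ws (m<n⇒m<1+n i′<i) x∈Wsi′
  ∪⊆ x∈ | inj₂ x∈Wsi = x∈unionBelow⁺ Ws ≤-refl x∈Wsi

module _ {n k} {F : Fin n → Subset k} {m} {Ws : Fin m → Subset n}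
         (hp : HallPartition F m Ws) where
  open HallPartition hp

  HallFrom : ℕ → Set
  HallFrom j = Hall (restrict F (unionBelow Ws j)) (∁ (unionBelow Ws j))

  HallFrom-m : HallFrom m
  HallFrom-m V V⊆ =
    subst (_≤ ∣ image (restrict F (unionBelow Ws m)) V ∣) (sym (Empty⇒∣p∣≡0 V=∅)) z≤n
    where
    covered : ∀ x → x ∈ unionBelow Ws m
    covered x with y∈image⁻ Ws (subst (x ∈_) (sym covers) ∈⊤)
    ... | i , _ , x∈Wsi = x∈unionBelow⁺ Ws (toℕ<n i) x∈Wsi
    V=∅ : Empty V
    V=∅ (x , x∈V) = x∈∁p⇒x∉p (V⊆ x∈V) (covered x)

  HallFrom-pred : ∀ i → HallFrom (suc (toℕ i)) → HallFrom (toℕ i)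
  HallFrom-pred i hallAfter = Hall-∪
    (NonReducible⇒Hall (nonReducible i) (nonemptyValues i _))
    (subst (λ U → Hall (restrict F U) (∁ U)) (unionBelow-suc Ws i) hallAfter)

  HallFrom-all : ∀ d j → d + j ≡ m → HallFrom j
  HallFrom-all zero    j refl = HallFrom-m
  HallFrom-all (suc d) j 1+d+j≡m =
    subst HallFrom (toℕ-fromℕ< j<m) (HallFrom-pred i (HallFrom-all d (suc (toℕ i)) d+1+i≡m))
    where
    j<m : j < m
    j<m = subst (j <_) 1+d+j≡m (s≤s (m≤n+m j d))
    i : Fin m
    i = fromℕ< j<m
    d+1+i≡m : d + suc (toℕ i) ≡ m
    d+1+i≡m = trans (+-suc d (toℕ i))
      (subst (λ t → suc (d + t) ≡ m) (sym (toℕ-fromℕ< j<m)) 1+d+j≡m)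

lemma6p2 : (n k : ℕ) → 1 ≤ n → 1 ≤ k →
    (F : Fin n → Subset k) (W : Subset n) → Critical ⊤ F W →
    (m : ℕ) (Ws : Fin m → Subset n) → HallPartition F m Ws →
    (i : Fin m) → W ⊆ ∁ (prefix Ws i) →
    Critical (∁ (prefix Ws i)) (restrict F (prefix Ws i)) W
lemma6p2 n k _ _ F W (_ , W≠∅ , ∣FW∣≡∣W∣) m Ws hp i W⊆ = W⊆ , W≠∅ , ≤-antisym upper lower
  where
  upper : ∣ image (restrict F (prefix Ws i)) W ∣ ≤ ∣ W ∣
  upper = subst (∣ image (restrict F (prefix Ws i)) W ∣ ≤_) ∣FW∣≡∣W∣
    (p⊆q⇒∣p∣≤∣q∣ (image-mono (λ {x} → p─q⊆p (F x) _) ⊆-refl))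
  lower : ∣ W ∣ ≤ ∣ image (restrict F (prefix Ws i)) W ∣
  lower = HallFrom-all hp (m ∸ toℕ i) (toℕ i) (m∸n+n≡m (<⇒≤ (toℕ<n i))) W W⊆
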